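{- Let $p$ be a prime and work in the rational function field $\mathbb{F}_p(x,y)$. For every $k\ge1$, $$\nu^{\theta(2k,p)}=-\frac{[0,1][0,2][2k+1,2k+3]}{[1,2][2k+1,2k+2][2k+2,2k+3]}\,[0,1]^{2\theta(2k+1,p)}.$$
   Context: For integers $i,j\ge0$, $[i,j]:=x^{p^i}y^{p^j}-x^{p^j}y^{p^i}\in\mathbb{F}_p[x,y]$, where $x,y$ are indeterminates. $\nu:=-\dfrac{[0,2][1,3]}{[0,1][2,3]}$. For $r\ge0$, $\theta(r,p):=\sum_{i=0}^{r}(-1)^{r-i}p^i=p^r-p^{r-1}+\cdots+(-1)^r$. -}

module Defs where

open import Data.Nat as ℕ using (ℕ; zero; suc; _≟_)
open import Data.Integer as ℤ using (ℤ; +_; -[1+_])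
open import Data.Integer.Divisibility using () renaming (_∣_ to _∣ℤ_)
open import Data.List using (List; []; _∷_; _++_; map; concatMap)
open import Data.Product using (_×_; _,_; proj₁; proj₂)
open import Data.Bool using (if_then_else_)
open import Relation.Nullary using (does)

-- A polynomial is a finite formal sum of terms  c · x^a y^b  with c ∈ ℤ
-- (read modulo p).

Term : Set
Term = ℤ × ℕ × ℕ

Poly : Set
Poly = List Term

coeff : Poly → ℕ → ℕ → ℤ
coeff []                  i j = + 0
coeff ((c , a , b) ∷ ts)  i j =
  (if does (a ≟ i) then (if does (b ≟ j) then c else + 0) else + 0)
  ℤ.+ coeff ts i j

_≈[_]_ : Poly → ℕ → Poly → Set
f ≈[ p ] g = ∀ i j → (+ p) ∣ℤ (coeff f i j ℤ.- coeff g i j)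

P0 P1 : Poly
P0 = []
P1 = (+ 1 , 0 , 0) ∷ []

_+P_ : Poly → Poly → Poly
_+P_ = _++_

-P_ : Poly → Poly
-P_ = map (λ { (c , a , b) → (ℤ.- c , a , b) })

_*P_ : Poly → Poly → Poly
f *P g = concatMap (λ { (c , a , b) →
           map (λ { (d , a' , b') → (c ℤ.* d , a ℕ.+ a' , b ℕ.+ b') }) g }) f

_^P_ : Poly → ℕ → Poly
f ^P zero  = P1
f ^P suc n = f *P (f ^P n)

infixl 7 _*F_ _/F_
infixr 8 _^F_ _^Fℕ_
infix 4 _≈F[_]_ _≈[_]_

record Frac : Set where
  constructor _//_
  field
    num : Poly
    den : Poly
open Frac public

_≈F[_]_ : Frac → ℕ → Frac → Set
(a // b) ≈F[ p ] (c // d) = (a *P d) ≈[ p ] (c *P b)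

poly : Poly → Frac
poly f = f // P1

_*F_ : Frac → Frac → Frac
(a // b) *F (c // d) = (a *P c) // (b *P d)

_/F_ : Frac → Frac → Frac
(a // b) /F (c // d) = (a *P d) // (b *P c)

-F_ : Frac → Frac
-F (a // b) = (-P a) // b

_^Fℕ_ : Frac → ℕ → Frac
(a // b) ^Fℕ n = (a ^P n) // (b ^P n)

_^F_ : Frac → ℤ → Frac
u ^F (+ n)     = u ^Fℕ n
u ^F -[1+ n ]  = poly P1 /F (u ^Fℕ suc n)

br : ℕ → ℕ → ℕ → Poly
br p i j = (+ 1 , p ℕ.^ i , p ℕ.^ j) ∷ (-[1+ 0 ] , p ℕ.^ j , p ℕ.^ i) ∷ []

B : ℕ → ℕ → ℕ → Frac
B p i j = poly (br p i j)

ν : ℕ → Frac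
ν p = -F ((B p 0 2 *F B p 1 3) /F (B p 0 1 *F B p 2 3))

-- θ(r,p) := Σ_{i=0}^{r} (-1)^{r-i} p^i
sgn : ℕ → ℤ
sgn zero          = + 1
sgn (suc zero)    = -[1+ 0 ]
sgn (suc (suc n)) = sgn n

θ : ℕ → ℕ → ℤ
θ r p = go r
  where
  go : ℕ → ℤ
  go zero    = sgn r
  go (suc i) = sgn (r ℕ.∸ suc i) ℤ.* (+ (p ℕ.^ suc i)) ℤ.+ go i

module Submission where

-- In characteristic p the map x ↦ x ^ p is additive (the middle binomial coefficients of
-- (x + y) ^ p vanish), so [i + 1, j + 1] = [i, j] ^ p and hence [i, j] = [0, j - i] ^ p ^ i.
-- With u = [0,1], v = [0,2] and P = p ^ (2k + 1) this gives ν = - v ^ (1 + p) / u ^ (1 + p²),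
-- and after clearing denominators both sides of the formula are signed monomials in u and v.
-- The formula thus reduces to θ(2k) being odd together with the exponent identities
--   (1 + p) θ(2k) = 1 + P   and   p + P + pP = 1 + 2 θ(2k + 1) + (1 + p²) θ(2k),
-- which follow from θ(r + 1) = p θ(r) + (-1)^(r + 1): it gives θ(2k + 1) = p θ(2k) - 1 and
-- θ(2k) = 1 + p (p - 1) (1 + p² + ⋯ + p^(2k - 2)).

open import Defs
open import Data.Nat as ℕ using (ℕ; zero; suc; _≟_; _≤_; _≰_; _<_; _≤?_; _∸_; z≤n; s≤s; _!)
import Data.Nat.Properties as ℕP
open import Data.Nat.Properties using (_!*_!≢0)
open import Data.Nat.Divisibility using (_∣_; divides; ∣⇒≤; m∣m*n)
open import Data.Nat.DivMod using (m/n*n≡m)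
open import Data.Nat.Primality using (Prime; euclidsLemma; prime⇒nonTrivial)
open import Data.Nat.Combinatorics using (_C_; k![n∸k]!∣n!; nCn≡1)
open import Data.Nat.Combinatorics.Specification using (nCk≡n!/k![n-k]!)
import Data.Nat.Tactic.RingSolver as ℕSolver
open import Data.Integer using (ℤ; +_; -[1+_])
  renaming (_+_ to _+ℤ_; _*_ to _*ℤ_; -_ to -ℤ_; _-_ to _-ℤ_)
import Data.Integer.Properties as ℤP
open import Data.Integer.Divisibility.Signed as ℤ∣ using () renaming (_∣_ to _∣ℤ_)
import Data.Integer.Tactic.RingSolver as ℤSolver
open import Data.Fin as Fin using (Fin; fromℕ)
import Data.Fin.Properties as Fin
open import Data.Vec.Functional using (replicate; init; tail)
open import Data.List using (List; []; _∷_; _++_; map)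
import Data.List.Properties as List
open import Data.Product using (∃; _,_)
open import Data.Sum using (inj₁; inj₂)
open import Data.Bool using (if_then_else_; true; false)
open import Function using (_∘_)
open import Relation.Nullary using (does; yes; no; contradiction)
open import Relation.Nullary.Decidable using (dec-false)
open import Relation.Binary.PropositionalEquality using (_≡_; refl; sym; trans; cong; cong₂; subst; module ≡-Reasoning)
open import Algebra.Bundles using (CommutativeRing)
open import Algebra.Structures using (IsCommutativeRing)

prime⇒>1 : ∀ {p} → Prime p → 1 < p
prime⇒>1 {p} p-prime = ℕ.nonTrivial⇒n>1 p {{prime⇒nonTrivial p-prime}}

p∣n!⇒p≤n : ∀ {p} → Prime p → ∀ n → p ∣ n ! → p ≤ n
p∣n!⇒p≤n p-prime zero    p∣1 = contradiction (∣⇒≤ p∣1) (ℕP.<⇒≱ (prime⇒>1 p-prime))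
p∣n!⇒p≤n p-prime (suc n) p∣n! with euclidsLemma (suc n) (n !) p-prime p∣n!
... | inj₁ p∣1+n = ∣⇒≤ p∣1+n
... | inj₂ p∣n!′ = ℕP.m≤n⇒m≤1+n (p∣n!⇒p≤n p-prime n p∣n!′)

nCk*k!*[n∸k]!≡n! : ∀ {n k} → k ≤ n → (n C k) ℕ.* (k ! ℕ.* (n ∸ k) !) ≡ n !
nCk*k!*[n∸k]!≡n! {n} {k} k≤n =
  trans (cong (ℕ._* (k ! ℕ.* (n ∸ k) !)) (nCk≡n!/k![n-k]! k≤n)) (m/n*n≡m (k![n∸k]!∣n! k≤n))
  where instance _ = k !* (n ∸ k) !≢0

p∣pCk : ∀ {p k} → Prime p → 0 < k → k < p → p ∣ p C k
p∣pCk {suc q} {k} p-prime 0<k k<p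
  with euclidsLemma (suc q C k) (k ! ℕ.* (suc q ∸ k) !) p-prime
         (subst (suc q ∣_) (sym (nCk*k!*[n∸k]!≡n! (ℕP.<⇒≤ k<p))) (m∣m*n (q !)))
... | inj₁ p∣pCk = p∣pCk
... | inj₂ p∣k!*[p∸k]! with euclidsLemma (k !) ((suc q ∸ k) !) p-prime p∣k!*[p∸k]!
...   | inj₁ p∣k!     = contradiction (p∣n!⇒p≤n p-prime k p∣k!) (ℕP.<⇒≱ k<p)
...   | inj₂ p∣[p∸k]! = contradiction (p∣n!⇒p≤n p-prime (suc q ∸ k) p∣[p∸k]!) (ℕP.<⇒≱ (ℕP.∸-monoʳ-< 0<k (ℕP.<⇒≤ k<p)))

module CommutativeRingProperties {c ℓ} (R : CommutativeRing c ℓ) where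

  open CommutativeRing R renaming (refl to ≈-refl; sym to ≈-sym; trans to ≈-trans)
  open import Algebra.Properties.Ring ring using (-‿distribˡ-*; -‿distribʳ-*; -‿involutive; +-inverseʳ-unique)
  open import Algebra.Properties.Semiring.Exp semiring using (_^_; ^-congˡ; ^-assocʳ; ^-homo-*)
  open import Algebra.Solver.CommutativeMonoid *-commutativeMonoid using (solve; _⊕_; _⊜_)
  open import Algebra.Properties.Semiring.Mult semiring using (_×_; ×-congˡ; ×-assocˡ)
  open import Algebra.Properties.Semiring.Sum semiring using (sum; sum-init-last; sum-cong-≋; sum-replicate-zero)
  open import Algebra.Properties.CommutativeSemiring.Binomial commutativeSemiring
    using (binomialTerm) renaming (theorem to binomial-theorem)
  open import Relation.Binary.Reasoning.Setoid setoid

  module Frobenius {q} (p-prime : Prime (suc q)) (char-p : ∀ x → suc q × x ≈ 0#) where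

    p : ℕ
    p = suc q

    ×-vanishes : ∀ {n} x → p ∣ n → n × x ≈ 0#
    ×-vanishes {n} x (divides t refl) = begin
      (t ℕ.* p) × x   ≈⟨ ×-congˡ (ℕP.*-comm t p) ⟩
      (p ℕ.* t) × x   ≈⟨ ×-assocˡ x p t ⟨
      p × (t × x)     ≈⟨ char-p (t × x) ⟩
      0#              ∎

    ^-homo-+ : ∀ x y → (x + y) ^ p ≈ x ^ p + y ^ p
    ^-homo-+ x y = begin
        (x + y) ^ suc q
      ≈⟨ binomial-theorem (suc q) x y ⟩
        term Fin.zero + sum (tail term)
      ≈⟨ +-congˡ (sum-init-last (tail term)) ⟩
        term Fin.zero + (sum (init (tail term)) + term (fromℕ (suc q)))
      ≈⟨ +-cong first (+-cong middle last) ⟩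
        y ^ suc q + (0# + x ^ suc q)
      ≈⟨ +-comm _ _ ⟩
        (0# + x ^ suc q) + y ^ suc q
      ≈⟨ +-congʳ (+-identityˡ _) ⟩
        x ^ suc q + y ^ suc q
      ∎
      where
      term : Fin (suc p) → Carrier
      term = binomialTerm x y p
      first : term Fin.zero ≈ y ^ suc q
      first = ≈-trans (+-identityʳ _) (*-identityˡ _)
      middle : sum (init (tail term)) ≈ 0#
      middle = ≈-trans (sum-cong-≋ {q} {init (tail term)} {replicate q 0#} λ k →
                        ×-vanishes _ (p∣pCk p-prime (s≤s z≤n) (s≤s (subst (_< q) (sym (Fin.toℕ-inject₁ k)) (Fin.toℕ<n k)))))
                     (sum-replicate-zero q)
      last : term (fromℕ (suc q)) ≈ x ^ suc q
      last rewrite Fin.toℕ-fromℕ q | nCn≡1 (suc q) | ℕP.n∸n≡0 q = ≈-trans (+-identityʳ _) (*-identityʳ _)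

    ^-homo-‿ : ∀ x → (- x) ^ p ≈ - (x ^ p)
    ^-homo-‿ x = +-inverseʳ-unique (x ^ p) ((- x) ^ p) (begin
      x ^ p + (- x) ^ p   ≈⟨ ^-homo-+ x (- x) ⟨
      (x - x) ^ p         ≈⟨ ^-congˡ p (-‿inverseʳ x) ⟩
      0# * 0# ^ q         ≈⟨ zeroˡ _ ⟩
      0#                  ∎)

    ^-homo-- : ∀ x y → (x - y) ^ p ≈ x ^ p - y ^ p
    ^-homo-- x y = ≈-trans (^-homo-+ x (- y)) (+-congˡ (^-homo-‿ y))

  -‿^-odd : ∀ x t → (- x) ^ suc (2 ℕ.* t) ≈ - (x ^ suc (2 ℕ.* t))
  -‿^-odd x t = begin
    - x * (- x) ^ (2 ℕ.* t)   ≈⟨ *-congˡ -‿^-even ⟩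
    - x * x ^ (2 ℕ.* t)       ≈⟨ -‿distribˡ-* x _ ⟨
    - (x * x ^ (2 ℕ.* t))     ∎
    where
    -‿square : (- x) ^ 2 ≈ x ^ 2
    -‿square = begin
      - x * (- x * 1#)     ≈⟨ -‿distribˡ-* x _ ⟨
      - (x * (- x * 1#))   ≈⟨ -‿cong (*-congˡ (-‿distribˡ-* x 1#)) ⟨
      - (x * - (x * 1#))   ≈⟨ -‿cong (-‿distribʳ-* x _) ⟨
      - - (x * (x * 1#))   ≈⟨ -‿involutive _ ⟩
      x * (x * 1#)         ∎
    -‿^-even : (- x) ^ (2 ℕ.* t) ≈ x ^ (2 ℕ.* t)
    -‿^-even = begin
      (- x) ^ (2 ℕ.* t)   ≈⟨ ^-assocʳ (- x) 2 t ⟨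
      ((- x) ^ 2) ^ t     ≈⟨ ^-congˡ t -‿square ⟩
      (x ^ 2) ^ t         ≈⟨ ^-assocʳ x 2 t ⟩
      x ^ (2 ℕ.* t)       ∎

  ν-power-identity : ∀ u v {p P N M} t → N ≡ suc (2 ℕ.* t) → suc p ℕ.* N ≡ suc P →
    p ℕ.+ P ℕ.+ p ℕ.* P ≡ suc (2 ℕ.* M) ℕ.+ suc (p ℕ.* p) ℕ.* N →
    (- (v * v ^ p)) ^ N * (u ^ p * u ^ P * u ^ (p ℕ.* P))
      ≈ - (u * v * v ^ P) * u ^ (2 ℕ.* M) * (u * u ^ (p ℕ.* p)) ^ N
  ν-power-identity u v {p} {P} {N} {M} t refl v-exponent u-exponent = begin
      (- (v * v ^ p)) ^ N * (u ^ p * u ^ P * u ^ (p ℕ.* P))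
    ≈⟨ *-cong v-side u-side ⟩
      - (v * v ^ P) * (u * u ^ (2 ℕ.* M) * (u * u ^ (p ℕ.* p)) ^ N)
    ≈⟨ -‿distribˡ-* _ _ ⟨
      - ((v * v ^ P) * (u * u ^ (2 ℕ.* M) * (u * u ^ (p ℕ.* p)) ^ N))
    ≈⟨ -‿cong (solve 5 (λ u v w a b → (v ⊕ w) ⊕ ((u ⊕ a) ⊕ b) ⊜ (((u ⊕ v) ⊕ w) ⊕ a) ⊕ b) ≈-refl
                        u v (v ^ P) (u ^ (2 ℕ.* M)) ((u * u ^ (p ℕ.* p)) ^ N)) ⟩
      - (u * v * v ^ P * u ^ (2 ℕ.* M) * (u * u ^ (p ℕ.* p)) ^ N)
    ≈⟨ -‿distribˡ-* _ _ ⟩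
      - (u * v * v ^ P * u ^ (2 ℕ.* M)) * (u * u ^ (p ℕ.* p)) ^ N
    ≈⟨ *-congʳ (-‿distribˡ-* _ _) ⟩
      - (u * v * v ^ P) * u ^ (2 ℕ.* M) * (u * u ^ (p ℕ.* p)) ^ N
    ∎
    where
    v-side : (- (v * v ^ p)) ^ N ≈ - (v * v ^ P)
    v-side = begin
      (- v ^ suc p) ^ N       ≈⟨ -‿^-odd (v ^ suc p) t ⟩
      - ((v ^ suc p) ^ N)     ≈⟨ -‿cong (^-assocʳ v (suc p) N) ⟩
      - v ^ (suc p ℕ.* N)     ≡⟨ cong (λ e → - v ^ e) v-exponent ⟩
      - v ^ suc P             ∎
    u-side : u ^ p * u ^ P * u ^ (p ℕ.* P) ≈ u * u ^ (2 ℕ.* M) * (u * u ^ (p ℕ.* p)) ^ N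
    u-side = begin
      u ^ p * u ^ P * u ^ (p ℕ.* P)                          ≈⟨ *-congʳ (^-homo-* u p P) ⟨
      u ^ (p ℕ.+ P) * u ^ (p ℕ.* P)                          ≈⟨ ^-homo-* u (p ℕ.+ P) (p ℕ.* P) ⟨
      u ^ (p ℕ.+ P ℕ.+ p ℕ.* P)                              ≡⟨ cong (u ^_) u-exponent ⟩
      u ^ (suc (2 ℕ.* M) ℕ.+ suc (p ℕ.* p) ℕ.* N)            ≈⟨ ^-homo-* u (suc (2 ℕ.* M)) _ ⟩
      u ^ suc (2 ℕ.* M) * u ^ (suc (p ℕ.* p) ℕ.* N)          ≈⟨ *-congˡ (^-assocʳ u (suc (p ℕ.* p)) N) ⟨
      u * u ^ (2 ℕ.* M) * (u * u ^ (p ℕ.* p)) ^ N            ∎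

_*ᵗ_ : Term → Term → Term
(c , a , b) *ᵗ (d , a′ , b′) = (c *ℤ d , a ℕ.+ a′ , b ℕ.+ b′)

-ᵗ_ : Term → Term
-ᵗ (c , a , b) = (-ℤ c , a , b)

coeffᵗ : Term → ℕ → ℕ → ℤ
coeffᵗ (c , a , b) i j = if does (a ≟ i) then (if does (b ≟ j) then c else + 0) else + 0

coeff-++ : ∀ f g i j → coeff (f ++ g) i j ≡ coeff f i j +ℤ coeff g i j
coeff-++ []      g i j = sym (ℤP.+-identityˡ _)
coeff-++ (t ∷ f) g i j = trans (cong (coeffᵗ t i j +ℤ_) (coeff-++ f g i j)) (sym (ℤP.+-assoc (coeffᵗ t i j) _ _))

coeffᵗ-neg : ∀ t i j → coeffᵗ (-ᵗ t) i j ≡ -ℤ coeffᵗ t i j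
coeffᵗ-neg (c , a , b) i j with does (a ≟ i) | does (b ≟ j)
... | true  | true  = refl
... | true  | false = refl
... | false | _     = refl

coeff-neg : ∀ f i j → coeff (-P f) i j ≡ -ℤ coeff f i j
coeff-neg []      i j = refl
coeff-neg (t ∷ f) i j =
  trans (cong₂ _+ℤ_ (coeffᵗ-neg t i j) (coeff-neg f i j)) (sym (ℤP.neg-distrib-+ (coeffᵗ t i j) _))

*P-distribʳ : ∀ f g h → (f ++ g) *P h ≡ f *P h ++ g *P h
*P-distribʳ []      g h = refl
*P-distribʳ (t ∷ f) g h =
  trans (cong (map (t *ᵗ_) h ++_) (*P-distribʳ f g h)) (sym (List.++-assoc (map (t *ᵗ_) h) _ _))

*P-negˡ : ∀ f g → (-P f) *P g ≡ -P (f *P g)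
*P-negˡ []      g = refl
*P-negˡ (t ∷ f) g = begin
    map ((-ᵗ t) *ᵗ_) g ++ (-P f) *P g
  ≡⟨ cong₂ _++_ (trans (List.map-cong (negˡ t) g) (List.map-∘ g)) (*P-negˡ f g) ⟩
    -P (map (t *ᵗ_) g) ++ -P (f *P g)
  ≡⟨ List.map-++ -ᵗ_ (map (t *ᵗ_) g) (f *P g) ⟨
    -P (map (t *ᵗ_) g ++ f *P g)
  ∎
  where
  open ≡-Reasoning
  negˡ : ∀ t s → (-ᵗ t) *ᵗ s ≡ -ᵗ (t *ᵗ s)
  negˡ (c , _ , _) (d , _ , _) = cong (_, _) (sym (ℤP.neg-distribˡ-* c d))

*ᵗ-assoc : ∀ t s r → (t *ᵗ s) *ᵗ r ≡ t *ᵗ (s *ᵗ r)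
*ᵗ-assoc (c , a , b) (d , a′ , b′) (e , a″ , b″) =
  cong₂ _,_ (ℤP.*-assoc c d e) (cong₂ _,_ (ℕP.+-assoc a a′ a″) (ℕP.+-assoc b b′ b″))

*ᵗ-comm : ∀ t s → t *ᵗ s ≡ s *ᵗ t
*ᵗ-comm (c , a , b) (d , a′ , b′) =
  cong₂ _,_ (ℤP.*-comm c d) (cong₂ _,_ (ℕP.+-comm a a′) (ℕP.+-comm b b′))

*P-assoc : ∀ f g h → (f *P g) *P h ≡ f *P (g *P h)
*P-assoc []      g h = refl
*P-assoc (t ∷ f) g h =
  trans (*P-distribʳ (map (t *ᵗ_) g) (f *P g) h) (cong₂ _++_ (map-*P g) (*P-assoc f g h))
  where
  map-*P : ∀ g → map (t *ᵗ_) g *P h ≡ map (t *ᵗ_) (g *P h)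
  map-*P []      = refl
  map-*P (s ∷ g) = begin
      map ((t *ᵗ s) *ᵗ_) h ++ map (t *ᵗ_) g *P h
    ≡⟨ cong₂ _++_ (trans (List.map-cong (*ᵗ-assoc t s) h) (List.map-∘ h)) (map-*P g) ⟩
      map (t *ᵗ_) (map (s *ᵗ_) h) ++ map (t *ᵗ_) (g *P h)
    ≡⟨ List.map-++ (t *ᵗ_) (map (s *ᵗ_) h) (g *P h) ⟨
      map (t *ᵗ_) (map (s *ᵗ_) h ++ g *P h)
    ∎
    where open ≡-Reasoning

*P-identityˡ : ∀ f → P1 *P f ≡ f
*P-identityˡ f = trans (List.++-identityʳ _) (trans (List.map-cong 1*ᵗ f) (List.map-id f))
  where
  1*ᵗ : ∀ s → (+ 1 , 0 , 0) *ᵗ s ≡ s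
  1*ᵗ (d , _ , _) = cong (_, _) (ℤP.*-identityˡ d)

*P-identityʳ : ∀ f → f *P P1 ≡ f
*P-identityʳ []              = refl
*P-identityʳ ((c , a , b) ∷ f) =
  cong₂ _∷_ (cong₂ _,_ (ℤP.*-identityʳ c) (cong₂ _,_ (ℕP.+-identityʳ a) (ℕP.+-identityʳ b)))
            (*P-identityʳ f)

coeff-*P-comm : ∀ f g i j → coeff (f *P g) i j ≡ coeff (g *P f) i j
coeff-*P-comm []      g i j = sym (cong (λ h → coeff h i j) (zeroʳ g))
  where
  zeroʳ : ∀ g → g *P [] ≡ []
  zeroʳ []      = refl
  zeroʳ (_ ∷ g) = zeroʳ g
coeff-*P-comm (t ∷ f) g i j = begin
    coeff (map (t *ᵗ_) g ++ f *P g) i j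
  ≡⟨ coeff-++ (map (t *ᵗ_) g) (f *P g) i j ⟩
    coeff (map (t *ᵗ_) g) i j +ℤ coeff (f *P g) i j
  ≡⟨ cong₂ _+ℤ_ (cong (λ h → coeff h i j) (List.map-cong (*ᵗ-comm t) g)) (coeff-*P-comm f g i j) ⟩
    coeff (map (_*ᵗ t) g) i j +ℤ coeff (g *P f) i j
  ≡⟨ cons-right g ⟨
    coeff (g *P (t ∷ f)) i j
  ∎
  where
  open ≡-Reasoning
  cons-right : ∀ g → coeff (g *P (t ∷ f)) i j ≡ coeff (map (_*ᵗ t) g) i j +ℤ coeff (g *P f) i j
  cons-right []      = refl
  cons-right (s ∷ g) = begin
      coeffᵗ (s *ᵗ t) i j +ℤ coeff (map (s *ᵗ_) f ++ g *P (t ∷ f)) i j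
    ≡⟨ cong (coeffᵗ (s *ᵗ t) i j +ℤ_) (trans (coeff-++ (map (s *ᵗ_) f) _ i j)
                                               (cong (coeff (map (s *ᵗ_) f) i j +ℤ_) (cons-right g))) ⟩
      coeffᵗ (s *ᵗ t) i j +ℤ (coeff (map (s *ᵗ_) f) i j +ℤ (coeff (map (_*ᵗ t) g) i j +ℤ coeff (g *P f) i j))
    ≡⟨ interchange (coeffᵗ (s *ᵗ t) i j) (coeff (map (s *ᵗ_) f) i j) _ _ ⟩
      (coeffᵗ (s *ᵗ t) i j +ℤ coeff (map (_*ᵗ t) g) i j) +ℤ (coeff (map (s *ᵗ_) f) i j +ℤ coeff (g *P f) i j)
    ≡⟨ cong (coeff (map (_*ᵗ t) (s ∷ g)) i j +ℤ_) (coeff-++ (map (s *ᵗ_) f) (g *P f) i j) ⟨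
      coeff (map (_*ᵗ t) (s ∷ g)) i j +ℤ coeff ((s ∷ g) *P f) i j
    ∎
    where
    interchange : ∀ a b c d → a +ℤ (b +ℤ (c +ℤ d)) ≡ (a +ℤ c) +ℤ (b +ℤ d)
    interchange = ℤSolver.solve-∀

coeff-*P-distribˡ : ∀ f g h i j → coeff (f *P (g ++ h)) i j ≡ coeff (f *P g) i j +ℤ coeff (f *P h) i j
coeff-*P-distribˡ f g h i j = begin
    coeff (f *P (g ++ h)) i j
  ≡⟨ coeff-*P-comm f (g ++ h) i j ⟩
    coeff ((g ++ h) *P f) i j
  ≡⟨ cong (λ k → coeff k i j) (*P-distribʳ g h f) ⟩
    coeff (g *P f ++ h *P f) i j
  ≡⟨ coeff-++ (g *P f) (h *P f) i j ⟩
    coeff (g *P f) i j +ℤ coeff (h *P f) i j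
  ≡⟨ cong₂ _+ℤ_ (coeff-*P-comm g f i j) (coeff-*P-comm h f i j) ⟩
    coeff (f *P g) i j +ℤ coeff (f *P h) i j
  ∎
  where open ≡-Reasoning

coeff-*P-negʳ : ∀ f g i j → coeff (f *P (-P g)) i j ≡ -ℤ coeff (f *P g) i j
coeff-*P-negʳ f g i j = begin
    coeff (f *P (-P g)) i j
  ≡⟨ coeff-*P-comm f (-P g) i j ⟩
    coeff ((-P g) *P f) i j
  ≡⟨ cong (λ k → coeff k i j) (*P-negˡ g f) ⟩
    coeff (-P (g *P f)) i j
  ≡⟨ coeff-neg (g *P f) i j ⟩
    -ℤ coeff (g *P f) i j
  ≡⟨ cong -ℤ_ (coeff-*P-comm g f i j) ⟩
    -ℤ coeff (f *P g) i j
  ∎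
  where open ≡-Reasoning

-- does (m ≟ n) computes as m ≡ᵇ n, which strips common successors.
does-+-cancelˡ : ∀ a m n → does (a ℕ.+ m ≟ a ℕ.+ n) ≡ does (m ≟ n)
does-+-cancelˡ zero    m n = refl
does-+-cancelˡ (suc a) m n = does-+-cancelˡ a m n

coeffᵗ-*ᵗ-shift : ∀ c a b s i j → coeffᵗ ((c , a , b) *ᵗ s) (a ℕ.+ i) (b ℕ.+ j) ≡ c *ℤ coeffᵗ s i j
coeffᵗ-*ᵗ-shift c a b (d , a′ , b′) i j
  rewrite does-+-cancelˡ a a′ i | does-+-cancelˡ b b′ j with does (a′ ≟ i) | does (b′ ≟ j)
... | true  | true  = refl
... | true  | false = sym (ℤP.*-zeroʳ c)
... | false | _     = sym (ℤP.*-zeroʳ c)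

m+n≡o⇒m≤o : ∀ {m n o} → m ℕ.+ n ≡ o → m ≤ o
m+n≡o⇒m≤o {m} {n} refl = ℕP.m≤m+n m n

coeffᵗ-*ᵗ-outside : ∀ c a b s i j → (a ≤ i → b ≰ j) → coeffᵗ ((c , a , b) *ᵗ s) i j ≡ + 0
coeffᵗ-*ᵗ-outside c a b (d , a′ , b′) i j out with a ≤? i | b ≤? j
... | no a≰i  | _       rewrite dec-false (a ℕ.+ a′ ≟ i) (a≰i ∘ m+n≡o⇒m≤o) = refl
... | yes a≤i | yes b≤j = contradiction b≤j (out a≤i)
... | yes _   | no b≰j  rewrite dec-false (b ℕ.+ b′ ≟ j) (b≰j ∘ m+n≡o⇒m≤o) with does (a ℕ.+ a′ ≟ i)
...   | true  = refl
...   | false = refl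

coeff-map-*ᵗ-shift : ∀ c a b h i j → coeff (map ((c , a , b) *ᵗ_) h) (a ℕ.+ i) (b ℕ.+ j) ≡ c *ℤ coeff h i j
coeff-map-*ᵗ-shift c a b []      i j = sym (ℤP.*-zeroʳ c)
coeff-map-*ᵗ-shift c a b (s ∷ h) i j =
  trans (cong₂ _+ℤ_ (coeffᵗ-*ᵗ-shift c a b s i j) (coeff-map-*ᵗ-shift c a b h i j))
        (sym (ℤP.*-distribˡ-+ c (coeffᵗ s i j) _))

coeff-map-*ᵗ-outside : ∀ c a b h i j → (a ≤ i → b ≰ j) → coeff (map ((c , a , b) *ᵗ_) h) i j ≡ + 0
coeff-map-*ᵗ-outside c a b []      i j out = refl
coeff-map-*ᵗ-outside c a b (s ∷ h) i j out =
  cong₂ _+ℤ_ (coeffᵗ-*ᵗ-outside c a b s i j out) (coeff-map-*ᵗ-outside c a b h i j out)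

∣ℤ0 : ∀ {d} → d ∣ℤ + 0
∣ℤ0 = ℤ∣.divides (+ 0) refl

∣-coeff-*P : ∀ {d} f h → (∀ i j → d ∣ℤ coeff h i j) → ∀ i j → d ∣ℤ coeff (f *P h) i j
∣-coeff-*P []              h d∣h i j = ∣ℤ0
∣-coeff-*P ((c , a , b) ∷ f) h d∣h i j =
  subst (_ ∣ℤ_) (sym (coeff-++ (map ((c , a , b) *ᵗ_) h) (f *P h) i j))
        (ℤ∣.∣m∣n⇒∣m+n (∣-coeff-map i j) (∣-coeff-*P f h d∣h i j))
  where
  ∣-coeff-map : ∀ i j → _ ∣ℤ coeff (map ((c , a , b) *ᵗ_) h) i j
  ∣-coeff-map i j with a ≤? i | b ≤? j
  ... | yes a≤i | yes b≤j with ℕP.m≤n⇒∃[o]m+o≡n a≤i | ℕP.m≤n⇒∃[o]m+o≡n b≤j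
  ...   | i′ , refl | j′ , refl =
    subst (_ ∣ℤ_) (sym (coeff-map-*ᵗ-shift c a b h i′ j′)) (ℤ∣.∣n⇒∣m*n c (d∣h i′ j′))
  ∣-coeff-map i j | no a≰i | _ =
    subst (_ ∣ℤ_) (sym (coeff-map-*ᵗ-outside c a b h i j (λ a≤i → contradiction a≤i a≰i))) ∣ℤ0
  ∣-coeff-map i j | yes _ | no b≰j =
    subst (_ ∣ℤ_) (sym (coeff-map-*ᵗ-outside c a b h i j (λ _ → b≰j))) ∣ℤ0

module Modulo (m : ℤ) where

  infix 4 _≈_

  -- A record rather than a function type, so that the polynomials can be inferred from a proof.
  record _≈_ (f g : Poly) : Set where
    constructor mod
    field ∣-coeff-diff : ∀ i j → m ∣ℤ coeff f i j -ℤ coeff g i j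
  open _≈_ public

  coeff-≡⇒≈ : ∀ {f g} → (∀ i j → coeff f i j ≡ coeff g i j) → f ≈ g
  coeff-≡⇒≈ {f} e = mod λ i j →
    subst (m ∣ℤ_) (trans (sym (ℤP.+-inverseʳ (coeff f i j))) (cong (λ x → coeff f i j -ℤ x) (e i j))) ∣ℤ0

  ≡⇒≈ : ∀ {f g} → f ≡ g → f ≈ g
  ≡⇒≈ refl = coeff-≡⇒≈ λ _ _ → refl

  ≈-refl : ∀ {f} → f ≈ f
  ≈-refl = ≡⇒≈ refl

  ≈-sym : ∀ {f g} → f ≈ g → g ≈ f
  ≈-sym {f} {g} (mod d) = mod λ i j →
    subst (m ∣ℤ_) (negate (coeff f i j) (coeff g i j)) (ℤ∣.∣m⇒∣-m (d i j))
    where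
    negate : ∀ a b → -ℤ (a -ℤ b) ≡ b -ℤ a
    negate = ℤSolver.solve-∀

  ≈-trans : ∀ {f g h} → f ≈ g → g ≈ h → f ≈ h
  ≈-trans {f} {g} {h} (mod d) (mod e) = mod λ i j →
    subst (m ∣ℤ_) (telescope (coeff f i j) (coeff g i j) (coeff h i j)) (ℤ∣.∣m∣n⇒∣m+n (d i j) (e i j))
    where
    telescope : ∀ a b c → (a -ℤ b) +ℤ (b -ℤ c) ≡ a -ℤ c
    telescope = ℤSolver.solve-∀

  +-cong : ∀ {f f′ g g′} → f ≈ f′ → g ≈ g′ → f ++ g ≈ f′ ++ g′
  +-cong {f} {f′} {g} {g′} (mod d) (mod e) = mod λ i j →
    subst (m ∣ℤ_) (trans (regroup (coeff f i j) (coeff f′ i j) (coeff g i j) (coeff g′ i j))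
                        (sym (cong₂ _-ℤ_ (coeff-++ f g i j) (coeff-++ f′ g′ i j))))
          (ℤ∣.∣m∣n⇒∣m+n (d i j) (e i j))
    where
    regroup : ∀ a b c d → (a -ℤ b) +ℤ (c -ℤ d) ≡ (a +ℤ c) -ℤ (b +ℤ d)
    regroup = ℤSolver.solve-∀

  -‿cong : ∀ {f g} → f ≈ g → -P f ≈ -P g
  -‿cong {f} {g} (mod d) = mod λ i j →
    subst (m ∣ℤ_) (trans (negate (coeff f i j) (coeff g i j)) (sym (cong₂ _-ℤ_ (coeff-neg f i j) (coeff-neg g i j))))
          (ℤ∣.∣m⇒∣-m (d i j))
    where
    negate : ∀ a b → -ℤ (a -ℤ b) ≡ (-ℤ a) -ℤ (-ℤ b)
    negate = ℤSolver.solve-∀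

  *-comm : ∀ f g → f *P g ≈ g *P f
  *-comm f g = coeff-≡⇒≈ (coeff-*P-comm f g)

  *-congˡ : ∀ f {g g′} → g ≈ g′ → f *P g ≈ f *P g′
  *-congˡ f {g} {g′} (mod d) = mod λ i j →
    subst (m ∣ℤ_) (coeff-*P-diff i j) (∣-coeff-*P f (g ++ -P g′) ∣-coeff-g-g′ i j)
    where
    ∣-coeff-g-g′ : ∀ i j → m ∣ℤ coeff (g ++ -P g′) i j
    ∣-coeff-g-g′ i j = subst (m ∣ℤ_) (sym (trans (coeff-++ g (-P g′) i j) (cong (coeff g i j +ℤ_) (coeff-neg g′ i j)))) (d i j)
    coeff-*P-diff : ∀ i j → coeff (f *P (g ++ -P g′)) i j ≡ coeff (f *P g) i j -ℤ coeff (f *P g′) i j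
    coeff-*P-diff i j = trans (coeff-*P-distribˡ f g (-P g′) i j) (cong (coeff (f *P g) i j +ℤ_) (coeff-*P-negʳ f g′ i j))

  *-cong : ∀ {f f′ g g′} → f ≈ f′ → g ≈ g′ → f *P g ≈ f′ *P g′
  *-cong {f} {f′} {g} {g′} f≈f′ g≈g′ =
    ≈-trans (*-congˡ f g≈g′) (≈-trans (*-comm f g′) (≈-trans (*-congˡ g′ f≈f′) (*-comm g′ f′)))

  isCommutativeRing : IsCommutativeRing _≈_ _++_ _*P_ -P_ P0 P1
  isCommutativeRing = record
    { isRing = record
      { +-isAbelianGroup = record
        { isGroup = record
          { isMonoid = record
            { isSemigroup = record
              { isMagma = record
                { isEquivalence = record { refl = ≈-refl ; sym = ≈-sym ; trans = ≈-trans }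
                ; ∙-cong = +-cong }
              ; assoc = λ f g h → ≡⇒≈ (List.++-assoc f g h) }
            ; identity = (λ _ → ≈-refl) , (λ f → ≡⇒≈ (List.++-identityʳ f)) }
          ; inverse = (λ f → coeff-≡⇒≈ λ i j → +-inverse (-P f) f i j (trans (sym (ℤP.neg-involutive _)) (cong -ℤ_ (sym (coeff-neg f i j)))))
                    , (λ f → coeff-≡⇒≈ λ i j → +-inverse f (-P f) i j (coeff-neg f i j))
          ; ⁻¹-cong = -‿cong }
        ; comm = λ f g → coeff-≡⇒≈ λ i j →
            trans (coeff-++ f g i j) (trans (ℤP.+-comm (coeff f i j) _) (sym (coeff-++ g f i j))) }
      ; *-cong = *-cong
      ; *-assoc = λ f g h → ≡⇒≈ (*P-assoc f g h)
      ; *-identity = (λ f → ≡⇒≈ (*P-identityˡ f)) , (λ f → ≡⇒≈ (*P-identityʳ f))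
      ; distrib = (λ f g h → coeff-≡⇒≈ λ i j → trans (coeff-*P-distribˡ f g h i j) (sym (coeff-++ (f *P g) _ i j)))
                , (λ f g h → ≡⇒≈ (*P-distribʳ g h f)) }
    ; *-comm = *-comm }
    where
    +-inverse : ∀ f g i j → coeff g i j ≡ -ℤ coeff f i j → coeff (f ++ g) i j ≡ coeff P0 i j
    +-inverse f g i j e = trans (coeff-++ f g i j) (trans (cong (coeff f i j +ℤ_) e) (ℤP.+-inverseʳ (coeff f i j)))

  ring : CommutativeRing _ _
  ring = record { isCommutativeRing = isCommutativeRing }

  open import Algebra.Properties.Semiring.Mult (CommutativeRing.semiring ring) using (_×_)

  coeff-× : ∀ n f i j → coeff (n × f) i j ≡ + n *ℤ coeff f i j
  coeff-× zero    f i j = refl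
  coeff-× (suc n) f i j = begin
      coeff (f ++ n × f) i j                   ≡⟨ coeff-++ f (n × f) i j ⟩
      coeff f i j +ℤ coeff (n × f) i j         ≡⟨ cong (coeff f i j +ℤ_) (coeff-× n f i j) ⟩
      coeff f i j +ℤ + n *ℤ coeff f i j        ≡⟨ ℤP.suc-* (+ n) (coeff f i j) ⟨
      + suc n *ℤ coeff f i j                   ∎
    where open ≡-Reasoning

  ×-vanishes : ∀ n f → m ∣ℤ + n → n × f ≈ P0
  ×-vanishes n f m∣n = mod λ i j →
    subst (m ∣ℤ_) (sym (trans (ℤP.+-identityʳ _) (coeff-× n f i j))) (ℤ∣.∣m⇒∣m*n (coeff f i j) m∣n)

-- Imported only here, because the ring modules above open their own _+_ and _*_.
open import Data.Nat using (_+_; _*_; _≥_)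

-- θ is defined through a local helper that cannot be named here.  The meta θ-partial is
-- solved by unification with that helper (the `with` turns the problem into a pattern), so
-- θ r p = θ-partial r p r holds by definition and θ-partial computes by the helper's clauses.
mutual
  θ-partial : ℕ → ℕ → ℕ → ℤ
  θ-partial = _

  θ-suc-unfold : ∀ r p → θ (suc r) p ≡ sgn (r ∸ r) *ℤ + (p ℕ.^ suc r) +ℤ θ-partial (suc r) p r
  θ-suc-unfold r p with suc r
  ... | _ = refl

θ-partial-suc : ∀ r p i → θ-partial (suc r) p (suc i) ≡ + p *ℤ θ-partial r p i +ℤ sgn (suc r)
θ-partial-suc r p zero = cong (_+ℤ sgn (suc r)) (trans (cong (sgn r *ℤ_) (cong +_ (ℕP.*-identityʳ p))) (ℤP.*-comm (sgn r) (+ p)))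
θ-partial-suc r p (suc i) = begin
    sgn (r ∸ suc i) *ℤ + (p * p ℕ.^ suc i) +ℤ θ-partial (suc r) p (suc i)
  ≡⟨ cong₂ (λ a b → sgn (r ∸ suc i) *ℤ a +ℤ b) (ℤP.pos-* p (p ℕ.^ suc i)) (θ-partial-suc r p i) ⟩
    sgn (r ∸ suc i) *ℤ (+ p *ℤ + (p ℕ.^ suc i)) +ℤ (+ p *ℤ θ-partial r p i +ℤ sgn (suc r))
  ≡⟨ factor (sgn (r ∸ suc i)) (+ p) (+ (p ℕ.^ suc i)) (θ-partial r p i) (sgn (suc r)) ⟩
    + p *ℤ (sgn (r ∸ suc i) *ℤ + (p ℕ.^ suc i) +ℤ θ-partial r p i) +ℤ sgn (suc r)
  ∎
  where
  open ≡-Reasoning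
  factor : ∀ s p x y z → s *ℤ (p *ℤ x) +ℤ (p *ℤ y +ℤ z) ≡ p *ℤ (s *ℤ x +ℤ y) +ℤ z
  factor = ℤSolver.solve-∀

θ-suc : ∀ r p → θ (suc r) p ≡ + p *ℤ θ r p +ℤ sgn (suc r)
θ-suc r p = trans (θ-suc-unfold r p) (θ-partial-suc r p r)

sgn-even : ∀ k → sgn (2 * k) ≡ + 1
sgn-even zero = refl
sgn-even (suc k) rewrite ℕP.*-suc 2 k = sgn-even k

sgn-odd : ∀ k → sgn (suc (2 * k)) ≡ -[1+ 0 ]
sgn-odd zero = refl
sgn-odd (suc k) = subst (λ n → sgn (suc n) ≡ -[1+ 0 ]) (sym (ℕP.*-suc 2 k)) (sgn-odd k)

consecutive-product-even : ∀ q → ∃ λ t → suc q * q ≡ 2 * t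
consecutive-product-even zero    = 0 , refl
consecutive-product-even (suc q) with consecutive-product-even q
... | t , e = t + suc q , (begin
    suc (suc q) * suc q         ≡⟨ expand q ⟩
    suc q * q + 2 * suc q       ≡⟨ cong (_+ 2 * suc q) e ⟩
    2 * t + 2 * suc q           ≡⟨ ℕP.*-distribˡ-+ 2 t (suc q) ⟨
    2 * (t + suc q)             ∎)
  where
  open ≡-Reasoning
  expand : ∀ q → (2 + q) * (1 + q) ≡ (1 + q) * q + 2 * (1 + q)
  expand = ℕSolver.solve-∀

module θ-values (q : ℕ) where

  p : ℕ
  p = suc q

  geometric : ℕ → ℕ
  geometric zero    = 0
  geometric (suc k) = 1 + p * p * geometric k

  P N M : ℕ → ℕ
  P k = p ℕ.^ suc (2 * k)
  N k = 1 + p * q * geometric k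
  M k = q + p * p * q * geometric k

  p*N≡1+M : ∀ k → p * N k ≡ 1 + M k
  p*N≡1+M k = identity q (geometric k)
    where
    identity : ∀ q g → (1 + q) * (1 + (1 + q) * q * g) ≡ 1 + (q + (1 + q) * (1 + q) * q * g)
    identity = ℕSolver.solve-∀

  p*M+1≡N : ∀ k → p * M k + 1 ≡ N (suc k)
  p*M+1≡N k = identity q (geometric k)
    where
    identity : ∀ q g → (1 + q) * (q + (1 + q) * (1 + q) * q * g) + 1 ≡ 1 + (1 + q) * q * (1 + (1 + q) * (1 + q) * g)
    identity = ℕSolver.solve-∀

  θ-even : ∀ k → θ (2 * k) p ≡ + N k
  θ-odd  : ∀ k → θ (2 * k + 1) p ≡ + M k
  θ-even zero    = cong (λ n → + suc n) (sym (ℕP.*-zeroʳ (p * q)))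
  θ-even (suc k) = begin
      θ (2 * suc k) p
    ≡⟨ cong (λ n → θ n p) (ℕP.*-suc 2 k) ⟩
      θ (suc (suc (2 * k))) p
    ≡⟨ θ-suc (suc (2 * k)) p ⟩
      + p *ℤ θ (suc (2 * k)) p +ℤ sgn (2 * k)
    ≡⟨ cong₂ (λ a b → + p *ℤ a +ℤ b) (trans (cong (λ r → θ r p) (ℕP.+-comm 1 (2 * k))) (θ-odd k)) (sgn-even k) ⟩
      + p *ℤ + M k +ℤ + 1
    ≡⟨ cong (_+ℤ + 1) (ℤP.pos-* p (M k)) ⟨
      + (p * M k) +ℤ + 1
    ≡⟨ ℤP.pos-+ (p * M k) 1 ⟨
      + (p * M k + 1)
    ≡⟨ cong +_ (p*M+1≡N k) ⟩
      + N (suc k)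
    ∎
    where open ≡-Reasoning
  θ-odd k = begin
      θ (2 * k + 1) p
    ≡⟨ cong (λ r → θ r p) (ℕP.+-comm (2 * k) 1) ⟩
      θ (suc (2 * k)) p
    ≡⟨ θ-suc (2 * k) p ⟩
      + p *ℤ θ (2 * k) p +ℤ sgn (suc (2 * k))
    ≡⟨ cong₂ (λ a b → + p *ℤ a +ℤ b) (θ-even k) (sgn-odd k) ⟩
      + p *ℤ + N k +ℤ -[1+ 0 ]
    ≡⟨ cong (_+ℤ -[1+ 0 ]) (ℤP.pos-* p (N k)) ⟨
      + (p * N k) +ℤ -[1+ 0 ]
    ≡⟨ cong (λ n → + n +ℤ -[1+ 0 ]) (p*N≡1+M k) ⟩
      + M k
    ∎
    where open ≡-Reasoning

  N-odd : ∀ k → ∃ λ t → N k ≡ suc (2 * t)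
  N-odd k with consecutive-product-even q
  ... | t , e = t * geometric k , cong suc (trans (cong (_* geometric k) e) (ℕP.*-assoc 2 t (geometric k)))

  P-closed-form : ∀ k → P k ≡ p + p * q * (1 + p) * geometric k
  P-closed-form zero    = identity q
    where
    identity : ∀ q → (1 + q) * 1 ≡ (1 + q) + (1 + q) * q * (2 + q) * 0
    identity = ℕSolver.solve-∀
  P-closed-form (suc k) = begin
      p ℕ.^ suc (2 * suc k)                               ≡⟨ cong (λ n → p ℕ.^ suc n) (ℕP.*-suc 2 k) ⟩
      p * (p * p ℕ.^ suc (2 * k))                         ≡⟨ cong (λ n → p * (p * n)) (P-closed-form k) ⟩
      p * (p * (p + p * q * (1 + p) * geometric k))     ≡⟨ identity q (geometric k) ⟩
      p + p * q * (1 + p) * geometric (suc k)           ∎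
    where
    open ≡-Reasoning
    identity : ∀ q g → (1 + q) * ((1 + q) * ((1 + q) + (1 + q) * q * (2 + q) * g))
                     ≡ (1 + q) + (1 + q) * q * (2 + q) * (1 + (1 + q) * (1 + q) * g)
    identity = ℕSolver.solve-∀

  [1+p]*N≡1+P : ∀ k → suc p * N k ≡ suc (P k)
  [1+p]*N≡1+P k rewrite P-closed-form k = identity q (geometric k)
    where
    identity : ∀ q g → (2 + q) * (1 + (1 + q) * q * g) ≡ 1 + ((1 + q) + (1 + q) * q * (2 + q) * g)
    identity = ℕSolver.solve-∀

  u-exponent : ∀ k → p + P k + p * P k ≡ suc (2 * M k) + suc (p * p) * N k
  u-exponent k rewrite P-closed-form k = identity q (geometric k)
    where
    identity : ∀ q g → (1 + q) + ((1 + q) + (1 + q) * q * (2 + q) * g) + (1 + q) * ((1 + q) + (1 + q) * q * (2 + q) * g)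
                     ≡ 1 + 2 * (q + (1 + q) * (1 + q) * q * g) + (1 + (1 + q) * (1 + q)) * (1 + (1 + q) * q * g)
    identity = ℕSolver.solve-∀

module PrimeCharacteristic (q : ℕ) (p-prime : Prime (suc q)) where

  open θ-values q
  open Modulo (+ p)
  open CommutativeRing ring using (-_; _-_; *-identityˡ; *-identityʳ)
  open import Algebra.Properties.Semiring.Exp (CommutativeRing.semiring ring) using (_^_; ^-congˡ; ^-congʳ; ^-assocʳ)
  open CommutativeRingProperties ring using (module Frobenius; ν-power-identity)
  open Frobenius p-prime (λ f → ×-vanishes p f ℤ∣.∣-refl) using (^-homo--)
  open import Relation.Binary.Reasoning.Setoid (CommutativeRing.setoid ring)

  ^P≈^ : ∀ f n → f ^P n ≈ f ^ n
  ^P≈^ f n = ≡⇒≈ (^P≡^ n)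
    where
    ^P≡^ : ∀ n → f ^P n ≡ f ^ n
    ^P≡^ zero    = refl
    ^P≡^ (suc n) = cong (f *P_) (^P≡^ n)

  monomial : ℕ → ℕ → Poly
  monomial a b = (+ 1 , a , b) ∷ []

  monomial-^ : ∀ a b n → monomial a b ^ n ≡ monomial (n * a) (n * b)
  monomial-^ a b zero    = refl
  monomial-^ a b (suc n) rewrite monomial-^ a b n = refl

  bracket-^p : ∀ i j → br p i j ^ p ≈ br p (suc i) (suc j)
  bracket-^p i j = begin
    (monomial (p ℕ.^ i) (p ℕ.^ j) - monomial (p ℕ.^ j) (p ℕ.^ i)) ^ p
      ≈⟨ ^-homo-- (monomial (p ℕ.^ i) (p ℕ.^ j)) (monomial (p ℕ.^ j) (p ℕ.^ i)) ⟩
    monomial (p ℕ.^ i) (p ℕ.^ j) ^ p - monomial (p ℕ.^ j) (p ℕ.^ i) ^ p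
      ≡⟨ cong₂ _-_ (monomial-^ (p ℕ.^ i) (p ℕ.^ j) p) (monomial-^ (p ℕ.^ j) (p ℕ.^ i) p) ⟩
    br p (suc i) (suc j)
      ∎

  bracket-as-power : ∀ i d {j} → i + d ≡ j → br p i j ≈ br p 0 d ^ (p ℕ.^ i)
  bracket-as-power zero    d refl = ≈-sym (*-identityʳ (br p 0 d))
  bracket-as-power (suc i) d refl = begin
    br p (suc i) (suc (i + d))          ≈⟨ bracket-^p i (i + d) ⟨
    br p i (i + d) ^ p                  ≈⟨ ^-congˡ p (bracket-as-power i d refl) ⟩
    (br p 0 d ^ (p ℕ.^ i)) ^ p          ≈⟨ ^-assocʳ (br p 0 d) (p ℕ.^ i) p ⟩
    br p 0 d ^ (p ℕ.^ i * p)            ≡⟨ cong (br p 0 d ^_) (ℕP.*-comm (p ℕ.^ i) p) ⟩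
    br p 0 d ^ (p ℕ.^ suc i)            ∎

  u v : Poly
  u = br p 0 1
  v = br p 0 2

  ones≈P1 : (P1 *P P1) *P P1 ≈ P1
  ones≈P1 = ≈-trans (*-identityʳ (P1 *P P1)) (*-identityʳ P1)

  ν-num : ∀ n → num (ν p ^Fℕ n) ≈ (- (v *P (v ^ p))) ^ n
  ν-num n = ≈-trans (^P≈^ _ n) (^-congˡ n (-‿cong (≈-trans (*-identityʳ _)
              (*-cong (≈-refl {v}) (≈-trans (bracket-as-power 1 2 refl) (^-congʳ v (ℕP.*-identityʳ p)))))))

  ν-den : ∀ n → den (ν p ^Fℕ n) ≈ (u *P (u ^ (p * p))) ^ n
  ν-den n = ≈-trans (^P≈^ _ n) (^-congˡ n (≈-trans (*-identityˡ _)
              (*-cong (≈-refl {u}) (≈-trans (bracket-as-power 2 1 refl) (^-congʳ u (cong (p *_) (ℕP.*-identityʳ p)))))))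

  ratio : ℕ → Frac
  ratio k = (B p 0 1 *F B p 0 2 *F B p (2 * k + 1) (2 * k + 3))
         /F (B p 1 2 *F B p (2 * k + 1) (2 * k + 2) *F B p (2 * k + 2) (2 * k + 3))

  ratio-num : ∀ k → num (ratio k) ≈ (u *P v) *P (v ^ P k)
  ratio-num k = ≈-trans (*-cong (*-cong (≈-refl {u *P v}) bracket) ones≈P1) (*-identityʳ _)
    where
    bracket : br p (2 * k + 1) (2 * k + 3) ≈ v ^ P k
    bracket = ≈-trans (bracket-as-power (2 * k + 1) 2 (ℕP.+-assoc (2 * k) 1 2))
                      (^-congʳ v (cong (p ℕ.^_) (ℕP.+-comm (2 * k) 1)))

  ratio-den : ∀ k → den (ratio k) ≈ ((u ^ p) *P (u ^ P k)) *P (u ^ (p * P k))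
  ratio-den k = ≈-trans (*-cong ones≈P1 (*-cong (*-cong first second) third)) (*-identityˡ _)
    where
    first : br p 1 2 ≈ u ^ p
    first = ≈-trans (bracket-as-power 1 1 refl) (^-congʳ u (ℕP.*-identityʳ p))
    second : br p (2 * k + 1) (2 * k + 2) ≈ u ^ P k
    second = ≈-trans (bracket-as-power (2 * k + 1) 1 (ℕP.+-assoc (2 * k) 1 1))
                     (^-congʳ u (cong (p ℕ.^_) (ℕP.+-comm (2 * k) 1)))
    third : br p (2 * k + 2) (2 * k + 3) ≈ u ^ (p * P k)
    third = ≈-trans (bracket-as-power (2 * k + 2) 1 (ℕP.+-assoc (2 * k) 2 1))
                    (^-congʳ u (cong (p ℕ.^_) (ℕP.+-comm (2 * k) 2)))

  ≈⇒≈[p] : ∀ {f g} → f ≈ g → f ≈[ p ] g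
  ≈⇒≈[p] f≈g i j = ℤ∣.∣⇒∣ᵤ (∣-coeff-diff f≈g i j)

  ≈F-intro : ∀ {x y a b c d} → num x ≈ a → den x ≈ b → num y ≈ c → den y ≈ d →
             a *P d ≈ c *P b → x ≈F[ p ] y
  ≈F-intro a≈ b≈ c≈ d≈ ad≈cb = ≈⇒≈[p] (≈-trans (*-cong a≈ d≈) (≈-trans ad≈cb (≈-sym (*-cong c≈ b≈))))

  P1^≈P1 : ∀ n → P1 ^P n ≈ P1
  P1^≈P1 zero    = ≈-refl
  P1^≈P1 (suc n) = ≈-trans (*-identityˡ _) (P1^≈P1 n)

  ν-power : ∀ k → ν p ^Fℕ N k ≈F[ p ] (-F (ratio k)) *F (B p 0 1 ^Fℕ (2 * M k))
  ν-power k with N-odd k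
  ... | t , N≡1+2t = ≈F-intro (ν-num (N k)) (ν-den (N k))
      (*-cong (-‿cong (ratio-num k)) (^P≈^ u (2 * M k)))
      (≈-trans (*-cong (ratio-den k) (P1^≈P1 (2 * M k))) (*-identityʳ _))
      (ν-power-identity u v {p} {P k} {N k} {M k} t N≡1+2t ([1+p]*N≡1+P k) (u-exponent k))

lemmaA2 : (p : ℕ) → Prime p → (k : ℕ) → k ≥ 1 →
    ν p ^F θ (2 * k) p
    ≈F[ p ]
    (-F ((B p 0 1 *F B p 0 2 *F B p (2 * k + 1) (2 * k + 3))
    /F (B p 1 2 *F B p (2 * k + 1) (2 * k + 2) *F B p (2 * k + 2) (2 * k + 3))))
    *F (B p 0 1 ^F (+ 2 *ℤ θ (2 * k + 1) p))
lemmaA2 zero    p-prime = contradiction (prime⇒>1 p-prime) λ ()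
-- The formula also holds for k = 0.
lemmaA2 (suc q) p-prime k _
  rewrite θ-values.θ-even q k | θ-values.θ-odd q k | sym (ℤP.pos-* 2 (θ-values.M q k)) =
  PrimeCharacteristic.ν-power q p-prime k
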